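{- Let $n\ge 2$, let $C$ be the unit $n$-cube, and let $T$ be a spanning tree of the $n$-Roberts graph. Place the ridge unfolding of $C$ along $T$ in $\mathbb{R}^{n-1}$ so that the centroids of the facets lie in $\mathbb{Z}^{n-1}$, so that facets adjacent in $T$ have centroids differing by a vector $\pm e_i$ (a standard unit vector or its negative). Then for any path $f_0,f_1,\dots,f_k$ in $T$, if some step $c(f_{j+1})-c(f_j)$ equals $e_i$ then no step $c(f_{l+1})-c(f_l)$ equals $-e_i$, where $c(f)$ denotes the centroid of facet $f$ in the unfolding.
   Context: The $n$-Roberts graph has $2n$ vertices (the facets of the $n$-cube), with every pair joined by an edge except pairs of opposite facets; spanning trees of it correspond to ridge unfoldings of the $n$-cube, in which the cube is cut along all ridges (codimension-two faces) except those shared by facets adjacent in the tree, and the facets are developed isometrically into $\mathbb{R}^{n-1}$ staying attached along the uncut ridges.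
   Formalization: The ridge unfolding is placed in ℚ^(n-1) instead of ℝ^(n-1), each facet being sent by a map that is defined and isometric on its rational points only. -}

module Defs where

open import Data.Nat using (ℕ; zero; suc)
open import Data.Integer using (ℤ; +_)
open import Data.Rational using (ℚ; 0ℚ; 1ℚ; ½; _+_; _-_; _*_; -_; _≤_; _<_; _/_)
open import Data.Fin using (Fin; zero; suc; inject₁)
open import Data.Bool using (Bool; true; false)
open import Data.Product using (_×_; _,_; proj₁; proj₂; Σ; ∃)
open import Data.Empty using (⊥)
open import Relation.Nullary using (¬_; Dec; yes; no)
open import Relation.Binary.PropositionalEquality using (_≡_; _≢_)
open import Data.Fin using (_≟_)
open import Function.Definitions using (Injective)

Point : ℕ → Set
Point k = Fin k → ℚ

_≈ᵥ_ : ∀ {k} → Point k → Point k → Set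
x ≈ᵥ y = ∀ i → x i ≡ y i

sumℚ : ∀ {k} → (Fin k → ℚ) → ℚ
sumℚ {zero}  f = 0ℚ
sumℚ {suc k} f = f zero + sumℚ (λ i → f (suc i))

dist² : ∀ {k} → Point k → Point k → ℚ
dist² x y = sumℚ (λ i → (x i - y i) * (x i - y i))

-- Facets of the unit n-cube [0,1]^n: facet (a , s) is {x | x a = s}
-- where s = false means 0 and s = true means 1.
Facet : ℕ → Set
Facet n = Fin n × Bool

bit : Bool → ℚ
bit false = 0ℚ
bit true  = 1ℚ

InFacet : ∀ {n} → Facet n → Point n → Set
InFacet (a , s) x = (x a ≡ bit s) × (∀ b → (0ℚ ≤ x b) × (x b ≤ 1ℚ))

InRelInt : ∀ {n} → Facet n → Point n → Set
InRelInt (a , s) x = (x a ≡ bit s) × (∀ b → b ≢ a → (0ℚ < x b) × (x b < 1ℚ))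

facetCentroid : ∀ {n} → Facet n → Point n
facetCentroid (a , s) b with b ≟ a
... | yes _ = bit s
... | no  _ = ½

-- The n-Roberts graph: two facets are adjacent iff they are neither equal
-- nor opposite, i.e. iff they are orthogonal to different axes.
RobertsAdj : ∀ {n} → Facet n → Facet n → Set
RobertsAdj f g = proj₁ f ≢ proj₁ g

IsWalk : ∀ {V : Set} (E : V → V → Set) {k : ℕ} → (Fin (suc k) → V) → Set
IsWalk E {k} p = ∀ (j : Fin k) → E (p (inject₁ j)) (p (suc j))

IsPath : ∀ {V : Set} (E : V → V → Set) {k : ℕ} → (Fin (suc k) → V) → Set
IsPath E p = IsWalk E p × Injective _≡_ _≡_ p

-- A cycle: at least three distinct vertices v0 … vk (k ≥ 2), consecutive
-- ones adjacent, and vk adjacent to v0.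
HasCycle : ∀ {V : Set} (E : V → V → Set) → Set
HasCycle {V} E = Σ ℕ λ k → Σ (Fin (suc (suc (suc k))) → V) λ p →
  IsPath E p × E (p (Data.Fin.fromℕ (suc (suc k)))) (p zero)

Connected : ∀ {V : Set} (E : V → V → Set) → Set
Connected {V} E = ∀ (u v : V) → Σ ℕ λ k → Σ (Fin (suc k) → V) λ p →
  IsWalk E p × (p zero ≡ u) × (p (Data.Fin.fromℕ k) ≡ v)

IsSpanningTreeOfRoberts : (n : ℕ) → (Facet n → Facet n → Set) → Set
IsSpanningTreeOfRoberts n T =
  (∀ f g → T f g → RobertsAdj f g) ×
  (∀ f g → T f g → T g f) ×
  Connected T × ¬ HasCycle T

-- A ridge unfolding of the unit (m+1)-cube along T, developed in ℚ^m:
-- each facet f is mapped by φ f, isometrically on f, into ℚ^m; facets adjacent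
-- in T stay attached along their common ridge and are developed to opposite
-- sides of it (their relative interiors have disjoint images).
IsRidgeUnfolding : (m : ℕ) → (T : Facet (suc m) → Facet (suc m) → Set) →
  (Facet (suc m) → Point (suc m) → Point m) → Set
IsRidgeUnfolding m T φ =
  (∀ f x y → InFacet f x → InFacet f y → dist² (φ f x) (φ f y) ≡ dist² x y) ×
  (∀ f g → T f g → ∀ x → InFacet f x → InFacet g x → φ f x ≈ᵥ φ g x) ×
  (∀ f g → T f g → ∀ x y → InRelInt f x → InRelInt g y → ¬ (φ f x ≈ᵥ φ g y))

centroid : ∀ {m} → (Facet (suc m) → Point (suc m) → Point m) → Facet (suc m) → Point m
centroid φ f = φ f (facetCentroid f)

IsIntegral : ∀ {m} → Point m → Set
IsIntegral x = ∀ i → ∃ λ (z : ℤ) → x i ≡ z / 1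

unitVec : ∀ {m} → Fin m → Point m
unitVec i j with i ≟ j
... | yes _ = 1ℚ
... | no  _ = 0ℚ

negVec : ∀ {m} → Point m → Point m
negVec x j = - (x j)

_-ᵥ_ : ∀ {m} → Point m → Point m → Point m
(x -ᵥ y) j = x j - y j

step : ∀ {m k} → (Facet (suc m) → Point (suc m) → Point m) →
  (Fin (suc k) → Facet (suc m)) → Fin k → Point m
step φ p j = centroid φ (p (suc j)) -ᵥ centroid φ (p (inject₁ j))

-- Write A f for the (integral) image of the centroid of facet f and, for a
-- facet F not parallel to g, let  direction g F  be twice the vector from A g
-- to the image, under the development of g, of the centre of the ridge g ∩ F.
-- Four facts about these directions carry the proof:
--   * across a tree edge g — h the centroid step A h - A g is direction g h
--     and direction h g is its negative; this is where integrality enters: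
--     the distances |A g - P| = |A h - P| = 1/2 to the common ridge centre P
--     give |A g + A h - 2P|² = 1 - |A g - A h|², and distinct integral points
--     are at distance at least 1, so A g + A h = 2P;
--   * directions towards non-parallel facets are unchanged across a tree edge;
--   * opposite facets give opposite directions, and direction g is injective.
-- All of them rest on one Euclidean fact: a map preserving squared distances
-- preserves relations x + y = z + w (proved via a polarization identity).
-- Along the path, after a step +u every later facet still "looks back" to
-- some earlier facet in direction -u; a later step -u would then lead back to
-- that earlier facet, contradicting injectivity of the path.
module Submission where

open import Defs
open import Data.Nat as ℕ using (ℕ; zero; suc; _≤_; s≤s)
import Data.Nat.Properties as ℕP
open import Data.Integer as ℤ using (ℤ; -[1+_]; +<+)
import Data.Integer.Properties as ℤP
open import Data.Rational as ℚ using (ℚ; 0ℚ; 1ℚ; ½; _+_; _-_; _*_; -_; _/_; toℚᵘ)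
  renaming (_≤_ to _≤ℚ_; _<_ to _<ℚ_)
import Data.Rational.Properties as ℚP
import Data.Rational.Unnormalised as ℚᵘ
import Data.Rational.Unnormalised.Properties as ℚᵘP
open import Data.Rational.Solver using (module +-*-Solver)
open +-*-Solver
open import Data.Fin as Fin using (Fin; zero; suc; toℕ; inject₁; _≟_)
import Data.Fin.Properties as FinP
open import Data.Fin.Induction using (<-weakInduction-startingFrom)
open import Data.Bool using (Bool; true; false) renaming (_≟_ to _≟ᵇ_)
open import Data.Product using (_×_; _,_; proj₁; proj₂; ∃)
open import Data.Sum using (_⊎_; inj₁; inj₂)
open import Data.Unit using (tt)
open import Function using (_∘_)
open import Function.Definitions using (Injective)
open import Relation.Nullary using (¬_; Dec; yes; no; contradiction)
open import Relation.Nullary.Decidable using (toWitness)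
open import Relation.Binary.Definitions using (tri<; tri≈; tri>)
open import Relation.Binary.PropositionalEquality
open ≡-Reasoning
import Algebra.Properties.Group as GroupProperties
open GroupProperties ℚP.+-0-group using (x∙y⁻¹≈ε⇒x≈y; x≈y⇒x∙y⁻¹≈ε; ∙-cancelʳ; ⁻¹-involutive)

sq : ℚ → ℚ
sq x = x * x

twice : ℚ → ℚ
twice x = x + x

halve : ∀ {x y} → twice x ≡ twice y → x ≡ y
halve {x} {y} 2x≡2y = begin
  x            ≡⟨ solve 1 (λ x → x := con ½ :* (x :+ x)) refl x ⟩
  ½ * twice x  ≡⟨ cong (½ *_) 2x≡2y ⟩
  ½ * twice y  ≡⟨ solve 1 (λ y → con ½ :* (y :+ y) := y) refl y ⟩
  y            ∎

twice-neg : ∀ x → twice (- x) ≡ - twice x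
twice-neg x = sym (ℚP.neg-distrib-+ x x)

sub-antisym : ∀ x y → x - y ≡ - (y - x)
sub-antisym = solve 2 (λ x y → x :- y := :- (y :- x)) refl

regroup : ∀ a b c d → a + b - c - d ≡ (a + b) - (c + d)
regroup = solve 4 (λ a b c d → a :+ b :- c :- d := (a :+ b) :- (c :+ d)) refl

-- Subtracting a vanishing difference l - r changes nothing; the three
-- rearrangements below each add such a difference to a solver identity.
cancel-defect : ∀ a {l r} → l ≡ r → a - (l - r) ≡ a
cancel-defect a l≡r = trans (cong (λ d → a - d) (x≈y⇒x∙y⁻¹≈ε l≡r)) (ℚP.+-identityʳ a)

shift : ∀ a b c d → a + b ≡ c + d → d - b ≡ a - c
shift a b c d e = begin
  d - b                         ≡⟨ solve 4 (λ a b c d → d :- b := (a :- c) :- ((a :+ b) :- (c :+ d))) refl a b c d ⟩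
  (a - c) - ((a + b) - (c + d)) ≡⟨ cancel-defect (a - c) e ⟩
  a - c                         ∎

reflect : ∀ x y z → x + y ≡ z + z → y - z ≡ - (x - z)
reflect x y z e = begin
  y - z                           ≡⟨ solve 3 (λ x y z → y :- z := (:- (x :- z)) :- ((z :+ z) :- (x :+ y))) refl x y z ⟩
  - (x - z) - ((z + z) - (x + y)) ≡⟨ cancel-defect (- (x - z)) (sym e) ⟩
  - (x - z)                       ∎

midpoint-offset : ∀ x y p → x + y ≡ p + p → twice (p - x) ≡ y - x
midpoint-offset x y p e = begin
  twice (p - x)                 ≡⟨ solve 3 (λ x y p → (p :- x) :+ (p :- x) := (y :- x) :- ((x :+ y) :- (p :+ p))) refl x y p ⟩
  (y - x) - ((x + y) - (p + p)) ≡⟨ cancel-defect (y - x) e ⟩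
  y - x                         ∎

sq-nonneg : ∀ x → 0ℚ ≤ℚ sq x
sq-nonneg x with ℚP.≤-total 0ℚ x
... | inj₁ 0≤x = ℚP.nonNegative⁻¹ _ {{ℚP.nonNeg*nonNeg⇒nonNeg x {{ℚ.nonNegative 0≤x}} x {{ℚ.nonNegative 0≤x}}}}
... | inj₂ x≤0 = ℚP.nonNegative⁻¹ _ {{ℚP.nonPos*nonPos⇒nonPos x {{ℚ.nonPositive x≤0}} x {{ℚ.nonPositive x≤0}}}}

sq-pos : ∀ x → x ≢ 0ℚ → 0ℚ <ℚ sq x
sq-pos x x≢0 with ℚP.<-cmp x 0ℚ
... | tri< x<0 _ _ = ℚP.positive⁻¹ _ {{ℚP.neg*neg⇒pos x {{ℚ.negative x<0}} x {{ℚ.negative x<0}}}}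
... | tri≈ _ x≡0 _ = contradiction x≡0 x≢0
... | tri> _ _ 0<x = ℚP.positive⁻¹ _ {{ℚP.pos*pos⇒pos x {{ℚ.positive 0<x}} x {{ℚ.positive 0<x}}}}

sum-cong : ∀ {k} {f g : Fin k → ℚ} → (∀ i → f i ≡ g i) → sumℚ f ≡ sumℚ g
sum-cong {zero}  e = refl
sum-cong {suc k} e = cong₂ _+_ (e zero) (sum-cong (λ i → e (suc i)))

sum-zero : ∀ k → sumℚ {k} (λ _ → 0ℚ) ≡ 0ℚ
sum-zero zero    = refl
sum-zero (suc k) = trans (cong (0ℚ +_) (sum-zero k)) (ℚP.+-identityʳ 0ℚ)

sum-supported : ∀ {k} (g : Fin k → ℚ) c → (∀ i → i ≢ c → g i ≡ 0ℚ) → sumℚ g ≡ g c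
sum-supported {suc k} g zero    g≡0 = trans (cong (g zero +_)
  (trans (sum-cong (λ i → g≡0 (suc i) λ ())) (sum-zero k))) (ℚP.+-identityʳ (g zero))
sum-supported {suc k} g (suc c) g≡0 = trans (cong (_+ sumℚ (λ i → g (suc i))) (g≡0 zero λ ()))
  (trans (ℚP.+-identityˡ _) (sum-supported (λ i → g (suc i)) c (λ i i≢c → g≡0 (suc i) (i≢c ∘ FinP.suc-injective))))

sumsq-nonneg : ∀ {k} (g : Fin k → ℚ) → 0ℚ ≤ℚ sumℚ (λ i → sq (g i))
sumsq-nonneg {zero}  g = ℚP.≤-refl
sumsq-nonneg {suc k} g = ℚP.+-mono-≤ (sq-nonneg (g zero)) (sumsq-nonneg (λ i → g (suc i)))

sq≤sumsq : ∀ {k} (g : Fin k → ℚ) i → sq (g i) ≤ℚ sumℚ (λ i → sq (g i))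
sq≤sumsq {suc k} g zero    = ℚP.≤-trans (ℚP.≤-reflexive (sym (ℚP.+-identityʳ _)))
  (ℚP.+-monoʳ-≤ (sq (g zero)) (sumsq-nonneg (λ i → g (suc i))))
sq≤sumsq {suc k} g (suc i) = ℚP.≤-trans (sq≤sumsq (λ i → g (suc i)) i)
  (ℚP.≤-trans (ℚP.≤-reflexive (sym (ℚP.+-identityˡ _))) (ℚP.+-monoˡ-≤ _ (sq-nonneg (g zero))))

sumsq-zero : ∀ {k} (g : Fin k → ℚ) → sumℚ (λ i → sq (g i)) ≡ 0ℚ → ∀ i → g i ≡ 0ℚ
sumsq-zero g sum≡0 i with g i ℚP.≟ 0ℚ
... | yes gᵢ≡0 = gᵢ≡0
... | no  gᵢ≢0 = contradiction (sym sum≡0) (ℚP.<⇒≢ (ℚP.<-≤-trans (sq-pos (g i) gᵢ≢0) (sq≤sumsq g i)))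

ι : ℤ → ℚ
ι z = z / 1

toℚᵘ-square-difference : ∀ a b →
  toℚᵘ (sq (ι a - ι b)) ℚᵘ.≃ (ℚᵘ.mkℚᵘ a 0 ℚᵘ.- ℚᵘ.mkℚᵘ b 0) ℚᵘ.* (ℚᵘ.mkℚᵘ a 0 ℚᵘ.- ℚᵘ.mkℚᵘ b 0)
toℚᵘ-square-difference a b =
  ℚᵘP.≃-trans (ℚP.toℚᵘ-homo-* (ι a - ι b) (ι a - ι b)) (ℚᵘP.*-cong difference difference)
  where
  difference : toℚᵘ (ι a - ι b) ℚᵘ.≃ ℚᵘ.mkℚᵘ a 0 ℚᵘ.- ℚᵘ.mkℚᵘ b 0
  difference = ℚᵘP.≃-trans (ℚP.toℚᵘ-homo-+ (ι a) (- ι b))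
    (ℚᵘP.+-cong (ℚP.toℚᵘ-fromℚᵘ (ℚᵘ.mkℚᵘ a 0))
                (ℚᵘP.≃-trans (ℚP.toℚᵘ-homo‿- (ι b)) (ℚᵘP.-‿cong (ℚP.toℚᵘ-fromℚᵘ (ℚᵘ.mkℚᵘ b 0)))))

square<1⇒0 : ∀ (d : ℤ) → d ℤ.* d ℤ.* ℤ.+ 1 ℤ.< ℤ.+ 1 ℤ.* ℤ.+ 1 → d ≡ ℤ.+ 0
square<1⇒0 (ℤ.+ zero)  _ = refl
square<1⇒0 (ℤ.+ suc n) (+<+ (s≤s ()))
square<1⇒0 -[1+ n ]    (+<+ (s≤s ()))

integers-near⇒equal : ∀ a b → sq (ι a - ι b) <ℚ 1ℚ → a ≡ b
integers-near⇒equal a b near with ℚᵘP.<-respˡ-≃ (toℚᵘ-square-difference a b) (ℚP.toℚᵘ-mono-< near)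
... | ℚᵘ.*<* d²<1 = ℤP.i-j≡0⇒i≡j a b (begin
  a ℤ.- b                            ≡⟨ cong₂ ℤ._+_ (ℤP.*-identityʳ a) (ℤP.*-identityʳ (ℤ.- b)) ⟨
  a ℤ.* ℤ.+ 1 ℤ.+ (ℤ.- b) ℤ.* ℤ.+ 1  ≡⟨ square<1⇒0 _ d²<1 ⟩
  ℤ.+ 0                              ∎)

integral-separation : ∀ {k} {x y : Point k} → IsIntegral x → IsIntegral y →
  ¬ x ≈ᵥ y → 1ℚ ≤ℚ dist² x y
integral-separation {x = x} {y} x∈ℤ y∈ℤ x≉y = ℚP.≮⇒≥ (λ d<1 → x≉y (λ i → coordinate i d<1))
  where
  coordinate : ∀ i → dist² x y <ℚ 1ℚ → x i ≡ y i
  coordinate i d<1 with x∈ℤ i | y∈ℤ i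
  ... | a , xᵢ≡a | b , yᵢ≡b = begin
    x i  ≡⟨ xᵢ≡a ⟩
    ι a  ≡⟨ cong ι (integers-near⇒equal a b near) ⟩
    ι b  ≡⟨ yᵢ≡b ⟨
    y i  ∎
    where
    near : sq (ι a - ι b) <ℚ 1ℚ
    near = subst₂ (λ u v → sq (u - v) <ℚ 1ℚ) xᵢ≡a yᵢ≡b
      (ℚP.≤-<-trans (sq≤sumsq (λ i → x i - y i) i) d<1)

-- Euclidean geometry of ℚ^k.

polarization : ∀ {k} (x y z w : Point k) →
  sumℚ (λ i → sq (x i + y i - z i - w i)) ≡
  dist² x z + dist² y w + dist² x w + dist² y z - dist² x y - dist² z w
polarization {zero}  x y z w = refl
polarization {suc k} x y z w =
  trans (cong (sq (x zero + y zero - z zero - w zero) +_) (polarization x′ y′ z′ w′))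
    (solve 10 (λ a b c d xz yw xw yz xy zw →
       (a :+ b :- c :- d) :* (a :+ b :- c :- d) :+ (xz :+ yw :+ xw :+ yz :- xy :- zw) :=
       ((a :- c) :* (a :- c) :+ xz) :+ ((b :- d) :* (b :- d) :+ yw) :+ ((a :- d) :* (a :- d) :+ xw)
         :+ ((b :- c) :* (b :- c) :+ yz) :- ((a :- b) :* (a :- b) :+ xy) :- ((c :- d) :* (c :- d) :+ zw))
       refl (x zero) (y zero) (z zero) (w zero)
       (dist² x′ z′) (dist² y′ w′) (dist² x′ w′) (dist² y′ z′) (dist² x′ y′) (dist² z′ w′))
  where
  x′ y′ z′ w′ : Point k
  x′ i = x (suc i)
  y′ i = y (suc i)
  z′ i = z (suc i)
  w′ i = w (suc i)

dist²≡0⇒≈ : ∀ {k} (x y : Point k) → dist² x y ≡ 0ℚ → x ≈ᵥ y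
dist²≡0⇒≈ x y d≡0 i = x∙y⁻¹≈ε⇒x≈y (x i) (y i) (sumsq-zero (λ i → x i - y i) d≡0 i)

≈⇒dist²≡0 : ∀ {k} (x y : Point k) → x ≈ᵥ y → dist² x y ≡ 0ℚ
≈⇒dist²≡0 {k} x y x≈y = trans (sum-cong (λ i → cong sq (x≈y⇒x∙y⁻¹≈ε (x≈y i)))) (sum-zero k)

dist²-congʳ : ∀ {k} (x : Point k) {y z} → y ≈ᵥ z → dist² x y ≡ dist² x z
dist²-congʳ x y≈z = sum-cong (λ i → cong (λ v → sq (x i - v)) (y≈z i))

dist²-one-coordinate : ∀ {k} (x y : Point k) c → (∀ i → i ≢ c → x i ≡ y i) → dist² x y ≡ sq (x c - y c)
dist²-one-coordinate x y c agree = sum-supported (λ i → sq (x i - y i)) c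
  (λ i i≢c → cong sq (x≈y⇒x∙y⁻¹≈ε (agree i i≢c)))

balanced-if-defect-vanishes : ∀ {k} (x y z w : Point k) →
  sumℚ (λ i → sq (x i + y i - z i - w i)) ≡ 0ℚ → ∀ i → x i + y i ≡ z i + w i
balanced-if-defect-vanishes x y z w defect≡0 i = x∙y⁻¹≈ε⇒x≈y (x i + y i) (z i + w i)
  (trans (sym (regroup (x i) (y i) (z i) (w i))) (sumsq-zero (λ i → x i + y i - z i - w i) defect≡0 i))

module Isometry {n k} (S : Point n → Set) (ψ : Point n → Point k)
  (isometric : ∀ x y → S x → S y → dist² (ψ x) (ψ y) ≡ dist² x y) where

  respects : ∀ {x y} → S x → S y → x ≈ᵥ y → ψ x ≈ᵥ ψ y
  respects {x} {y} x∈S y∈S x≈y =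
    dist²≡0⇒≈ (ψ x) (ψ y) (trans (isometric x y x∈S y∈S) (≈⇒dist²≡0 x y x≈y))

  injective : ∀ {x y} → S x → S y → ψ x ≈ᵥ ψ y → x ≈ᵥ y
  injective {x} {y} x∈S y∈S ψx≈ψy =
    dist²≡0⇒≈ x y (trans (sym (isometric x y x∈S y∈S)) (≈⇒dist²≡0 (ψ x) (ψ y) ψx≈ψy))

  parallelogram : ∀ {x y z w} → S x → S y → S z → S w →
    (∀ i → x i + y i ≡ z i + w i) → ∀ i → ψ x i + ψ y i ≡ ψ z i + ψ w i
  parallelogram {x} {y} {z} {w} x∈S y∈S z∈S w∈S balanced =
    balanced-if-defect-vanishes (ψ x) (ψ y) (ψ z) (ψ w) (begin
      sumℚ (λ i → sq (ψ x i + ψ y i - ψ z i - ψ w i))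
        ≡⟨ polarization (ψ x) (ψ y) (ψ z) (ψ w) ⟩
      dist² (ψ x) (ψ z) + dist² (ψ y) (ψ w) + dist² (ψ x) (ψ w) + dist² (ψ y) (ψ z)
        - dist² (ψ x) (ψ y) - dist² (ψ z) (ψ w)
        ≡⟨ cong₂ _-_ (cong₂ _-_ (cong₂ _+_ (cong₂ _+_ (cong₂ _+_ (d x∈S z∈S) (d y∈S w∈S)) (d x∈S w∈S))
                                            (d y∈S z∈S))
                                (d x∈S y∈S))
                     (d z∈S w∈S) ⟩
      dist² x z + dist² y w + dist² x w + dist² y z - dist² x y - dist² z w
        ≡⟨ polarization x y z w ⟨
      sumℚ (λ i → sq (x i + y i - z i - w i))
        ≡⟨ sum-cong (λ i → cong sq (regroup (x i) (y i) (z i) (w i))) ⟩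
      dist² (λ i → x i + y i) (λ i → z i + w i)
        ≡⟨ ≈⇒dist²≡0 (λ i → x i + y i) (λ i → z i + w i) balanced ⟩
      0ℚ ∎)
    where
    d : ∀ {u v} → S u → S v → dist² (ψ u) (ψ v) ≡ dist² u v
    d = isometric _ _

InUnitInterval : ℚ → Set
InUnitInterval q = (0ℚ ≤ℚ q) × (q ≤ℚ 1ℚ)

InCube : ∀ {n} → Point n → Set
InCube x = ∀ b → InUnitInterval (x b)

bit-inUnitInterval : ∀ t → InUnitInterval (bit t)
bit-inUnitInterval false = toWitness {a? = 0ℚ ℚP.≤? 0ℚ} tt , toWitness {a? = 0ℚ ℚP.≤? 1ℚ} tt
bit-inUnitInterval true  = toWitness {a? = 0ℚ ℚP.≤? 1ℚ} tt , toWitness {a? = 1ℚ ℚP.≤? 1ℚ} tt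

½-strictly-inside : (0ℚ <ℚ ½) × (½ <ℚ 1ℚ)
½-strictly-inside = toWitness {a? = 0ℚ ℚP.<? ½} tt , toWitness {a? = ½ ℚP.<? 1ℚ} tt

½-inUnitInterval : InUnitInterval ½
½-inUnitInterval = ℚP.<⇒≤ (proj₁ ½-strictly-inside) , ℚP.<⇒≤ (proj₂ ½-strictly-inside)

centroid-here : ∀ {n} (a : Fin n) s → facetCentroid (a , s) a ≡ bit s
centroid-here a s with a ≟ a
... | yes _   = refl
... | no  a≢a = contradiction refl a≢a

centroid-elsewhere : ∀ {n} (a : Fin n) s {i} → i ≢ a → facetCentroid (a , s) i ≡ ½
centroid-elsewhere a s {i} i≢a with i ≟ a
... | yes i≡a = contradiction i≡a i≢a
... | no  _   = refl

centroid-inCube : ∀ {n} (f : Facet n) → InCube (facetCentroid f)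
centroid-inCube (a , s) i with i ≟ a
... | yes _ = bit-inUnitInterval s
... | no  _ = ½-inUnitInterval

centroid-inFacet : ∀ {n} (f : Facet n) → InFacet f (facetCentroid f)
centroid-inFacet (a , s) = centroid-here a s , centroid-inCube (a , s)

centroid-inRelInt : ∀ {n} (f : Facet n) → InRelInt f (facetCentroid f)
centroid-inRelInt (a , s) = centroid-here a s , λ b b≢a →
  subst (λ q → (0ℚ <ℚ q) × (q <ℚ 1ℚ)) (sym (centroid-elsewhere a s b≢a)) ½-strictly-inside

-- fix x F moves the point x onto the hyperplane of the facet F; applied to
-- the centre of a face it gives the centre of the face cut out by F.
fix : ∀ {n} → Point n → Facet n → Point n
fix x (c , t) i with i ≟ c
... | yes _ = bit t
... | no  _ = x i

fix-here : ∀ {n} (x : Point n) c t → fix x (c , t) c ≡ bit t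
fix-here x c t with c ≟ c
... | yes _   = refl
... | no  c≢c = contradiction refl c≢c

fix-elsewhere : ∀ {n} (x : Point n) c t {i} → i ≢ c → fix x (c , t) i ≡ x i
fix-elsewhere x c t {i} i≢c with i ≟ c
... | yes i≡c = contradiction i≡c i≢c
... | no  _   = refl

fix-inCube : ∀ {n} {x : Point n} → InCube x → ∀ F → InCube (fix x F)
fix-inCube x∈C (c , t) i with i ≟ c
... | yes _ = bit-inUnitInterval t
... | no  _ = x∈C i

fix-stays : ∀ {n} {c : Fin n} a s {x} → InFacet (a , s) x → a ≢ c → ∀ t →
  InFacet (a , s) (fix x (c , t))
fix-stays a s {x} (xₐ≡s , x∈C) a≢c t = trans (fix-elsewhere x _ t a≢c) xₐ≡s , fix-inCube x∈C (_ , t)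

fix-enters : ∀ {n} {x : Point n} → InCube x → ∀ c t → InFacet (c , t) (fix x (c , t))
fix-enters {x = x} x∈C c t = fix-here x c t , fix-inCube x∈C (c , t)

fix-swap : ∀ {n} (x y : Point n) d s → x d ≡ y d →
  ∀ i → fix x (d , s) i + y i ≡ x i + fix y (d , s) i
fix-swap x y d s xd≡yd i with i ≟ d
... | yes refl = trans (ℚP.+-comm (bit s) (y i)) (cong (_+ bit s) (sym xd≡yd))
... | no  _    = refl

ridgeCentre : ∀ {n} → Facet n → Facet n → Point n
ridgeCentre g F = fix (facetCentroid g) F

ridgeCentre-inOther : ∀ {n} (g : Facet n) c t → InFacet (c , t) (ridgeCentre g (c , t))
ridgeCentre-inOther g c t = fix-enters (centroid-inCube g) c t

module _ {n} {a c : Fin n} (a≢c : a ≢ c) (s : Bool) where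

  ridgeCentre-inFacet : ∀ t → InFacet (a , s) (ridgeCentre (a , s) (c , t))
  ridgeCentre-inFacet t = fix-stays a s (centroid-inFacet (a , s)) a≢c t

  ridgeCentre-sym : ∀ t → ridgeCentre (a , s) (c , t) ≈ᵥ ridgeCentre (c , t) (a , s)
  ridgeCentre-sym t i = by-cases (i ≟ c) (i ≟ a)
    where
    by-cases : Dec (i ≡ c) → Dec (i ≡ a) → ridgeCentre (a , s) (c , t) i ≡ ridgeCentre (c , t) (a , s) i
    by-cases (yes refl) (yes refl) = contradiction refl a≢c
    by-cases (yes refl) (no  i≢a)  = begin
      fix (facetCentroid (a , s)) (i , t) i  ≡⟨ fix-here _ i t ⟩
      bit t                                  ≡⟨ centroid-here i t ⟨
      facetCentroid (i , t) i                ≡⟨ fix-elsewhere _ a s i≢a ⟨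
      fix (facetCentroid (i , t)) (a , s) i  ∎
    by-cases (no  i≢c)  (yes refl) = begin
      fix (facetCentroid (i , s)) (c , t) i  ≡⟨ fix-elsewhere _ c t i≢c ⟩
      facetCentroid (i , s) i                ≡⟨ centroid-here i s ⟩
      bit s                                  ≡⟨ fix-here _ i s ⟨
      fix (facetCentroid (c , t)) (i , s) i  ∎
    by-cases (no  i≢c)  (no  i≢a)  = begin
      fix (facetCentroid (a , s)) (c , t) i  ≡⟨ fix-elsewhere _ c t i≢c ⟩
      facetCentroid (a , s) i                ≡⟨ centroid-elsewhere a s i≢a ⟩
      ½                                      ≡⟨ centroid-elsewhere c t i≢c ⟨
      facetCentroid (c , t) i                ≡⟨ fix-elsewhere _ a s i≢a ⟨
      fix (facetCentroid (c , t)) (a , s) i  ∎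

  ridgeCentre-dist² : ∀ t → dist² (facetCentroid (a , s)) (ridgeCentre (a , s) (c , t)) ≡ ½ * ½
  ridgeCentre-dist² t = begin
    dist² (facetCentroid (a , s)) (ridgeCentre (a , s) (c , t))
      ≡⟨ dist²-one-coordinate _ _ c (λ i i≢c → sym (fix-elsewhere (facetCentroid (a , s)) c t i≢c)) ⟩
    sq (facetCentroid (a , s) c - fix (facetCentroid (a , s)) (c , t) c)
      ≡⟨ cong₂ (λ u v → sq (u - v)) (centroid-elsewhere a s (a≢c ∘ sym)) (fix-here (facetCentroid (a , s)) c t) ⟩
    sq (½ - bit t)
      ≡⟨ half-gap t ⟩
    ½ * ½ ∎
    where
    half-gap : ∀ t → sq (½ - bit t) ≡ ½ * ½
    half-gap false = refl
    half-gap true  = refl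

  opposite-ridges : ∀ {t t'} → t ≢ t' → ∀ i →
    ridgeCentre (a , s) (c , t) i + ridgeCentre (a , s) (c , t') i ≡ facetCentroid (a , s) i + facetCentroid (a , s) i
  opposite-ridges {t} {t'} t≢t' i with i ≟ c
  ... | yes refl = trans (bits-average t t' t≢t') (sym (cong₂ _+_ centreᵢ≡½ centreᵢ≡½))
    where
    centreᵢ≡½ : facetCentroid (a , s) i ≡ ½
    centreᵢ≡½ = centroid-elsewhere a s (a≢c ∘ sym)
    bits-average : ∀ t t' → t ≢ t' → bit t + bit t' ≡ ½ + ½
    bits-average false false t≢t' = contradiction refl t≢t'
    bits-average false true  _    = refl
    bits-average true  false _    = refl
    bits-average true  true  t≢t' = contradiction refl t≢t'
  ... | no  _    = refl

  ridgeCentre-injective : ∀ {c' t t'} → a ≢ c' →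
    ridgeCentre (a , s) (c , t) ≈ᵥ ridgeCentre (a , s) (c' , t') → (c , t) ≡ (c' , t')
  ridgeCentre-injective {c'} {t} {t'} a≢c' same with c ≟ c'
  ... | yes refl = cong (c ,_) (bit-injective (begin
    bit t                           ≡⟨ fix-here _ c t ⟨
    ridgeCentre (a , s) (c , t) c   ≡⟨ same c ⟩
    ridgeCentre (a , s) (c , t') c  ≡⟨ fix-here _ c t' ⟩
    bit t'                          ∎))
    where
    bit-injective : ∀ {t t'} → bit t ≡ bit t' → t ≡ t'
    bit-injective {false} {false} _ = refl
    bit-injective {true}  {true}  _ = refl
  ... | no  c≢c' = contradiction (begin
    bit t                           ≡⟨ fix-here _ c t ⟨
    ridgeCentre (a , s) (c , t) c   ≡⟨ same c ⟩
    ridgeCentre (a , s) (c' , t') c ≡⟨ fix-elsewhere _ c' t' c≢c' ⟩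
    facetCentroid (a , s) c         ≡⟨ centroid-elsewhere a s (a≢c ∘ sym) ⟩
    ½                               ∎) (bit≢½ t)
    where
    bit≢½ : ∀ t → bit t ≢ ½
    bit≢½ false ()
    bit≢½ true  ()

-- Directions in a ridge unfolding.

axis : ∀ {n} → Facet n → Fin n
axis = proj₁

module Unfolding {m : ℕ} {T : Facet (suc m) → Facet (suc m) → Set}
  {φ : Facet (suc m) → Point (suc m) → Point m}
  (edge⇒adjacent : ∀ f g → T f g → RobertsAdj f g)
  (ridge-unfolding : IsRidgeUnfolding m T φ)
  (integral : ∀ f → IsIntegral (centroid φ f)) where

  isometric : ∀ f x y → InFacet f x → InFacet f y → dist² (φ f x) (φ f y) ≡ dist² x y
  isometric = proj₁ ridge-unfolding

  glued : ∀ f g → T f g → ∀ x → InFacet f x → InFacet g x → φ f x ≈ᵥ φ g x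
  glued = proj₁ (proj₂ ridge-unfolding)

  separated : ∀ f g → T f g → ∀ x y → InRelInt f x → InRelInt g y → ¬ (φ f x ≈ᵥ φ g y)
  separated = proj₂ (proj₂ ridge-unfolding)

  module OnFacet (f : Facet (suc m)) = Isometry (InFacet f) (φ f) (isometric f)

  offset : Facet (suc m) → Facet (suc m) → Point m
  offset g F i = φ g (ridgeCentre g F) i - centroid φ g i

  direction : Facet (suc m) → Facet (suc m) → Point m
  direction g F i = twice (offset g F i)

  direction-injective : ∀ {a s c t c' t'} → a ≢ c → a ≢ c' →
    direction (a , s) (c , t) ≈ᵥ direction (a , s) (c' , t') → (c , t) ≡ (c' , t')
  direction-injective {a} {s} {c} {t} {c'} {t'} a≢c a≢c' same-direction =
    ridgeCentre-injective a≢c s a≢c' (OnFacet.injective (a , s)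
      (ridgeCentre-inFacet a≢c s t) (ridgeCentre-inFacet a≢c' s t')
      (λ i → ∙-cancelʳ (- centroid φ (a , s) i) _ _ (halve (same-direction i))))

  direction-opposite : ∀ {a s c t t'} → a ≢ c → t ≢ t' →
    direction (a , s) (c , t') ≈ᵥ negVec (direction (a , s) (c , t))
  direction-opposite {a} {s} {c} {t} {t'} a≢c t≢t' i = begin
    twice (φ g R' i - A i)    ≡⟨ cong twice (reflect (φ g R i) (φ g R' i) (A i) balanced) ⟩
    twice (- (φ g R i - A i)) ≡⟨ twice-neg (φ g R i - A i) ⟩
    - twice (φ g R i - A i)   ∎
    where
    g = (a , s)
    A = centroid φ g
    R = ridgeCentre g (c , t)
    R' = ridgeCentre g (c , t')
    balanced : φ g R i + φ g R' i ≡ A i + A i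
    balanced = OnFacet.parallelogram g (ridgeCentre-inFacet a≢c s t) (ridgeCentre-inFacet a≢c s t')
      (centroid-inFacet g) (centroid-inFacet g) (opposite-ridges a≢c s t≢t') i

  -- Across a tree edge g — h, a facet F parallel to neither is seen in the
  -- same direction: with R the common ridge centre and R' the centre of
  -- g ∩ h ∩ F, both offsets towards F equal the developed vector R' - R.
  direction-transport : ∀ {b t c t' d s'} → T (b , t) (c , t') → d ≢ b → d ≢ c →
    direction (c , t') (d , s') ≈ᵥ direction (b , t) (d , s')
  direction-transport {b} {t} {c} {t'} {d} {s'} edge d≢b d≢c i = cong twice (begin
    φ h Fʰ i - centroid φ h i ≡⟨ shift (φ h R' i) (centroid φ h i) (φ h R i) (φ h Fʰ i) parallelogramʰ ⟩
    φ h R' i - φ h R i        ≡⟨ cong₂ _-_ (glued g h edge R' R'∈g R'∈h i) (glued g h edge R R∈g R∈h i) ⟨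
    φ g R' i - φ g R i        ≡⟨ shift (φ g R' i) (centroid φ g i) (φ g R i) (φ g Fᵍ i) parallelogramᵍ ⟨
    φ g Fᵍ i - centroid φ g i ∎)
    where
    g = (b , t)
    h = (c , t')
    b≢c : b ≢ c
    b≢c = edge⇒adjacent g h edge
    R = ridgeCentre g h
    R' = fix R (d , s')
    Fᵍ = ridgeCentre g (d , s')
    Fʰ = ridgeCentre h (d , s')
    R∈g : InFacet g R
    R∈g = ridgeCentre-inFacet b≢c t t'
    R∈h : InFacet h R
    R∈h = ridgeCentre-inOther g c t'
    R'∈g : InFacet g R'
    R'∈g = fix-stays b t R∈g (d≢b ∘ sym) s'
    R'∈h : InFacet h R'
    R'∈h = fix-stays c t' R∈h (d≢c ∘ sym) s'
    Rd≡cᵍ : R d ≡ facetCentroid g d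
    Rd≡cᵍ = fix-elsewhere (facetCentroid g) c t' d≢c
    Rd≡cʰ : R d ≡ facetCentroid h d
    Rd≡cʰ = trans Rd≡cᵍ (trans (centroid-elsewhere b t d≢b) (sym (centroid-elsewhere c t' d≢c)))
    parallelogramᵍ : φ g R' i + centroid φ g i ≡ φ g R i + φ g Fᵍ i
    parallelogramᵍ = OnFacet.parallelogram g R'∈g (centroid-inFacet g) R∈g
      (ridgeCentre-inFacet (d≢b ∘ sym) t s') (fix-swap R (facetCentroid g) d s' Rd≡cᵍ) i
    parallelogramʰ : φ h R' i + centroid φ h i ≡ φ h R i + φ h Fʰ i
    parallelogramʰ = OnFacet.parallelogram h R'∈h (centroid-inFacet h) R∈h
      (ridgeCentre-inFacet (d≢c ∘ sym) t' s') (fix-swap R (facetCentroid h) d s' Rd≡cʰ) i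

  common-ridge-centre : ∀ {b t c t'} → T (b , t) (c , t') →
    φ (c , t') (ridgeCentre (c , t') (b , t)) ≈ᵥ φ (b , t) (ridgeCentre (b , t) (c , t'))
  common-ridge-centre {b} {t} {c} {t'} edge i =
    trans (OnFacet.respects h (ridgeCentre-inFacet (b≢c ∘ sym) t' t) R∈h (λ i → sym (ridgeCentre-sym b≢c t t' i)) i)
          (sym (glued g h edge R (ridgeCentre-inFacet b≢c t t') R∈h i))
    where
    g = (b , t)
    h = (c , t')
    b≢c : b ≢ c
    b≢c = edge⇒adjacent g h edge
    R = ridgeCentre g h
    R∈h : InFacet h R
    R∈h = ridgeCentre-inOther g c t'

  -- The centroids of a tree edge g — h are symmetric about the developed
  -- common ridge centre P: |A + B - 2P|² = 1 - |A - B|² ≤ 0 since the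
  -- distinct integral points A, B are at distance at least 1.
  centroids-symmetric : ∀ {b t c t'} → T (b , t) (c , t') →
    ∀ i → centroid φ (b , t) i + centroid φ (c , t') i ≡ twice (φ (b , t) (ridgeCentre (b , t) (c , t')) i)
  centroids-symmetric {b} {t} {c} {t'} edge =
    balanced-if-defect-vanishes A B P P (ℚP.≤-antisym defect≤0 (sumsq-nonneg (λ i → A i + B i - P i - P i)))
    where
    g = (b , t)
    h = (c , t')
    A = centroid φ g
    B = centroid φ h
    b≢c : b ≢ c
    b≢c = edge⇒adjacent g h edge
    P = φ g (ridgeCentre g h)
    A-to-P : dist² A P ≡ ½ * ½
    A-to-P = trans (isometric g _ (ridgeCentre g h) (centroid-inFacet g) (ridgeCentre-inFacet b≢c t t'))
                   (ridgeCentre-dist² b≢c t t')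
    B-to-P : dist² B P ≡ ½ * ½
    B-to-P = trans (sym (dist²-congʳ B (common-ridge-centre edge)))
      (trans (isometric h _ (ridgeCentre h g) (centroid-inFacet h) (ridgeCentre-inFacet (b≢c ∘ sym) t' t))
             (ridgeCentre-dist² (b≢c ∘ sym) t' t))
    A-to-B : 1ℚ ≤ℚ dist² A B
    A-to-B = integral-separation (integral g) (integral h)
      (separated g h edge _ _ (centroid-inRelInt g) (centroid-inRelInt h))
    defect≡1-S : sumℚ (λ i → sq (A i + B i - P i - P i)) ≡ 1ℚ - dist² A B
    defect≡1-S = begin
      sumℚ (λ i → sq (A i + B i - P i - P i))
        ≡⟨ polarization A B P P ⟩
      dist² A P + dist² B P + dist² A P + dist² B P - dist² A B - dist² P P
        ≡⟨ cong₂ (λ u v → u + v + u + v - dist² A B - dist² P P) A-to-P B-to-P ⟩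
      ¼ + ¼ + ¼ + ¼ - dist² A B - dist² P P
        ≡⟨ cong (λ z → ¼ + ¼ + ¼ + ¼ - dist² A B - z) (≈⇒dist²≡0 P P (λ _ → refl)) ⟩
      ¼ + ¼ + ¼ + ¼ - dist² A B - 0ℚ
        ≡⟨ solve 1 (λ S → con ¼ :+ con ¼ :+ con ¼ :+ con ¼ :- S :- con 0ℚ := con 1ℚ :- S) refl (dist² A B) ⟩
      1ℚ - dist² A B ∎
      where ¼ = ½ * ½
    defect≤0 : sumℚ (λ i → sq (A i + B i - P i - P i)) ≤ℚ 0ℚ
    defect≤0 = ℚP.≤-trans (ℚP.≤-reflexive defect≡1-S) (ℚP.+-monoʳ-≤ 1ℚ (ℚP.neg-antimono-≤ A-to-B))

  step-is-direction : ∀ {b t c t'} → T (b , t) (c , t') →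
    (centroid φ (c , t') -ᵥ centroid φ (b , t)) ≈ᵥ direction (b , t) (c , t')
  step-is-direction {b} {t} {c} {t'} edge i =
    sym (midpoint-offset (centroid φ (b , t) i) (centroid φ (c , t') i) (φ (b , t) (ridgeCentre (b , t) (c , t')) i)
      (centroids-symmetric edge i))

  direction-back : ∀ {b t c t'} → T (b , t) (c , t') →
    direction (c , t') (b , t) ≈ᵥ negVec (centroid φ (c , t') -ᵥ centroid φ (b , t))
  direction-back {b} {t} {c} {t'} edge i = begin
    twice (φ h (ridgeCentre h g) i - B i) ≡⟨ cong (λ v → twice (v - B i)) (common-ridge-centre edge i) ⟩
    twice (P i - B i)                     ≡⟨ midpoint-offset (B i) (A i) (P i) (trans (ℚP.+-comm (B i) (A i))
                                                                                      (centroids-symmetric edge i)) ⟩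
    A i - B i                             ≡⟨ sub-antisym (A i) (B i) ⟩
    - (B i - A i)                         ∎
    where
    g = (b , t)
    h = (c , t')
    A = centroid φ g
    B = centroid φ h
    P = φ g (ridgeCentre g h)

  direction-across-edge : ∀ {g h F} → T g h → axis g ≢ axis F →
    (axis h ≢ axis F × direction h F ≈ᵥ direction g F) ⊎
    (F ≡ h) ⊎
    (axis h ≢ axis g × direction h g ≈ᵥ direction g F)
  direction-across-edge {b , t} {c , t'} {d , s'} edge b≢d with d ≟ c
  ... | no  d≢c  = inj₁ (d≢c ∘ sym , direction-transport edge (b≢d ∘ sym) d≢c)
  ... | yes refl with s' ≟ᵇ t'
  ...   | yes refl  = inj₂ (inj₁ refl)
  ...   | no  s'≢t' = inj₂ (inj₂ (b≢d ∘ sym , λ i → begin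
    direction h g i                     ≡⟨ direction-back edge i ⟩
    - (centroid φ h i - centroid φ g i) ≡⟨ cong -_ (step-is-direction edge i) ⟩
    - direction g h i                   ≡⟨ cong -_ (direction-opposite b≢d s'≢t' i) ⟩
    - - direction g (d , s') i          ≡⟨ ⁻¹-involutive _ ⟩
    direction g (d , s') i              ∎))
    where
    g = (b , t)
    h = (d , t')

  step-determines-neighbour : ∀ {g h F} → T g h → axis g ≢ axis F →
    (centroid φ h -ᵥ centroid φ g) ≈ᵥ direction g F → h ≡ F
  step-determines-neighbour {b , t} {c , t'} {d , s'} edge b≢d step≈dir =
    direction-injective (edge⇒adjacent _ _ edge) b≢d (λ i → trans (sym (step-is-direction edge i)) (step≈dir i))

  module AlongPath {k} (p : Fin (suc k) → Facet (suc m)) (walk : IsWalk T p)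
    (p-injective : Injective _≡_ _≡_ p) (u : Point m) (j : Fin k) (step-j : step φ p j ≈ᵥ u) where

    LooksBack : Fin (suc k) → Set
    LooksBack x = ∃ λ q → q Fin.< x × axis (p x) ≢ axis (p q) × direction (p x) (p q) ≈ᵥ negVec u

    inject₁<suc : ∀ (l : Fin k) → inject₁ l Fin.< suc l
    inject₁<suc l = FinP.≤̄⇒inject₁< ℕP.≤-refl

    earlier-differs : ∀ l q → q Fin.< inject₁ l → p (suc l) ≢ p q
    earlier-differs l q q<l same =
      FinP.<-irrefl (p-injective (sym same)) (FinP.<-trans q<l (inject₁<suc l))

    looksBack-start : LooksBack (suc j)
    looksBack-start = inject₁ j , inject₁<suc j , edge⇒adjacent _ _ (walk j) ∘ sym ,
      λ i → trans (direction-back (walk j) i) (cong -_ (step-j i))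

    looksBack-propagates : ∀ l → LooksBack (inject₁ l) → LooksBack (suc l)
    looksBack-propagates l (q , q<l , g≢F , looks-at-F) with direction-across-edge (walk l) g≢F
    ... | inj₁ (h≢F , same-direction) =
      q , FinP.<-trans q<l (inject₁<suc l) , h≢F , λ i → trans (same-direction i) (looks-at-F i)
    ... | inj₂ (inj₁ F≡h) = contradiction (sym F≡h) (earlier-differs l q q<l)
    ... | inj₂ (inj₂ (h≢g , same-direction)) =
      inject₁ l , inject₁<suc l , h≢g , λ i → trans (same-direction i) (looks-at-F i)

    -- A step -u out of a facet looking back in direction -u would return to
    -- the earlier facet it looks at.
    no-reverse-step : ∀ l → LooksBack (inject₁ l) → ¬ step φ p l ≈ᵥ negVec u
    no-reverse-step l (q , q<l , g≢F , looks-at-F) step-l = earlier-differs l q q<l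
      (step-determines-neighbour (walk l) g≢F (λ i → trans (step-l i) (sym (looks-at-F i))))

    no-later-reverse : ∀ l → j Fin.< l → ¬ step φ p l ≈ᵥ negVec u
    no-later-reverse l j<l = no-reverse-step l
      (<-weakInduction-startingFrom LooksBack looksBack-start looksBack-propagates
        (subst (suc (toℕ j) ℕ.≤_) (sym (FinP.toℕ-inject₁ l)) j<l))

unitVec-diagonal : ∀ {m} (i : Fin m) → unitVec i i ≡ 1ℚ
unitVec-diagonal i with i ≟ i
... | yes _   = refl
... | no  i≢i = contradiction refl i≢i

unitVec≉negated : ∀ {m} (i : Fin m) → ¬ unitVec i ≈ᵥ negVec (unitVec i)
unitVec≉negated i e = 1≢-1 (begin
  1ℚ            ≡⟨ unitVec-diagonal i ⟨
  unitVec i i   ≡⟨ e i ⟩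
  - unitVec i i ≡⟨ cong -_ (unitVec-diagonal i) ⟩
  - 1ℚ          ∎)
  where
  1≢-1 : 1ℚ ≢ - 1ℚ
  1≢-1 ()

-- A step +e_i and a step -e_i cannot both occur: whichever comes second is
-- excluded by no-later-reverse (applied to u = e_i or u = -e_i), and they
-- cannot be the same step.
mainTheorem4 : (m : ℕ) → 1 ≤ m →
    (T : Facet (suc m) → Facet (suc m) → Set) → IsSpanningTreeOfRoberts (suc m) T →
    (φ : Facet (suc m) → Point (suc m) → Point m) → IsRidgeUnfolding m T φ →
    (∀ f → IsIntegral (centroid φ f)) →
    (k : ℕ) (p : Fin (suc k) → Facet (suc m)) → IsPath T p →
    (i : Fin m) → (j : Fin k) → step φ p j ≈ᵥ unitVec i →
    (l : Fin k) → ¬ (step φ p l ≈ᵥ negVec (unitVec i))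
mainTheorem4 m _ T (edge⇒adjacent , _) φ ridge-unfolding integral k p (walk , p-injective) i j step-j l step-l
  with FinP.<-cmp j l
... | tri< j<l _ _ = Unfolding.AlongPath.no-later-reverse edge⇒adjacent ridge-unfolding integral
  p walk p-injective (unitVec i) j step-j l j<l step-l
... | tri≈ _ refl _ = unitVec≉negated i (λ t → trans (sym (step-j t)) (step-l t))
... | tri> _ _ l<j = Unfolding.AlongPath.no-later-reverse edge⇒adjacent ridge-unfolding integral
  p walk p-injective (negVec (unitVec i)) l step-l j l<j (λ t → trans (step-j t) (sym (⁻¹-involutive (unitVec i t))))
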